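{- Let $\mathcal{D}$ be a self-orthogonal $t$-$(v,k,\lambda)$ design with $k$ even, and suppose that $C(\mathcal{D})$ is self-dual. Let $\overline{\mathcal{D}}$ be the complementary design and $\mathbf{1}$ the all-one vector of length $v$. Then $C(\mathcal{D})=C(\overline{\mathcal{D}})$ if $\mathbf{1}\in C(\overline{\mathcal{D}})$, and otherwise $C(\overline{\mathcal{D}}) \subset C(\mathcal{D})$ with $|C(\mathcal{D}):C(\overline{\mathcal{D}})|=2$.
   Context: A $t$-$(v,k,\lambda)$ design is a set of $v$ points with a collection of $k$-subsets (blocks), with no repeated blocks, such that every $t$-subset of points lies in exactly $\lambda$ blocks. It is self-orthogonal if the cardinality of the intersection of any two distinct blocks has the same parity as $k$. The complementary design $\overline{\mathcal{D}}$ is obtained by replacing each block by its complement in the point set. $C(\mathcal{D})$ denotes the binary linear code spanned over $\mathbb{F}_2$ by the characteristic vectors of the blocks of $\mathcal{D}$; a code is self-dual if it equals its dual under the standard inner product. -}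

module Defs where

open import Data.Nat using (ℕ; zero; suc; _%_)
open import Data.Bool using (Bool; true; false; _xor_; _∧_)
open import Data.Vec using (Vec; []; _∷_; zipWith; replicate; foldr)
open import Data.List using (List; length; filter; map)
open import Data.List.Membership.Propositional using (_∈_)
open import Data.List.Relation.Unary.Unique.Propositional using (Unique)
open import Data.Fin.Subset using (Subset; ∣_∣; _∩_; ∁; _⊆_)
open import Data.Fin.Subset.Properties using (_⊆?_)
open import Data.Product using (Σ; ∃; _×_; _,_)
open import Data.Sum using (_⊎_)
open import Relation.Binary.PropositionalEquality using (_≡_; _≢_)
open import Relation.Nullary using (¬_)

-- Points are Fin v; a block is a subset of the points (Subset v = Vec Bool v),
-- identified with its characteristic vector in F₂^v (true = 1, false = 0).
-- A design is given by its list of blocks.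

countContaining : ∀ {v} → Subset v → List (Subset v) → ℕ
countContaining T B = length (filter (T ⊆?_) B)

record IsDesign (t v k lam : ℕ) (B : List (Subset v)) : Set where
  field
    noRepeats   : Unique B
    blockSize   : ∀ b → b ∈ B → ∣ b ∣ ≡ k
    balanced    : ∀ (T : Subset v) → ∣ T ∣ ≡ t → countContaining T B ≡ lam

SelfOrthogonal : ∀ {v} → ℕ → List (Subset v) → Set
SelfOrthogonal k B = ∀ b c → b ∈ B → c ∈ B → b ≢ c → ∣ b ∩ c ∣ % 2 ≡ k % 2

complement : ∀ {v} → List (Subset v) → List (Subset v)
complement B = map ∁ B

Word : ℕ → Set
Word v = Vec Bool v

_⊕_ : ∀ {v} → Word v → Word v → Word v
_⊕_ = zipWith _xor_

zeroW : ∀ {v} → Word v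
zeroW = replicate _ false

allOne : ∀ {v} → Word v
allOne = replicate _ true

inner : ∀ {v} → Word v → Word v → Bool
inner x y = foldr _ _xor_ false (zipWith _∧_ x y)

Code : ℕ → Set₁
Code v = Word v → Set

combo : ∀ {v} (gs : List (Word v)) → Vec Bool (length gs) → Word v
combo Data.List.[] [] = zeroW
combo (g Data.List.∷ gs) (true ∷ c) = g ⊕ combo gs c
combo (g Data.List.∷ gs) (false ∷ c) = combo gs c

C : ∀ {v} → List (Subset v) → Code v
C B w = Σ (Vec Bool (length B)) λ c → combo B c ≡ w

Dual : ∀ {v} → Code v → Code v
Dual K w = ∀ u → K u → inner u w ≡ false

_⊆C_ : ∀ {v} → Code v → Code v → Set
K ⊆C L = ∀ w → K w → L w

_≐_ : ∀ {v} → Code v → Code v → Set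
K ≐ L = (K ⊆C L) × (L ⊆C K)

SelfDual : ∀ {v} → Code v → Set
SelfDual K = K ≐ Dual K

-- S is a subcode of K of index exactly 2: S ⊆ K and K is the union of exactly
-- two cosets of S, namely S and a + S for some a ∈ K \ S.
Index2 : ∀ {v} → Code v → Code v → Set
Index2 K S = (S ⊆C K) × (Σ (Word _) λ a → K a × ¬ S a × (∀ w → K w → S w ⊎ S (a ⊕ w)))

-- A self-dual binary code K contains the all-one vector 1: for u ∈ K, u · 1 = u · u = 0 as K ⊆ K⊥.
-- The complement of a block b is 1 ⊕ b, so a combination of complemented blocks differs from the
-- same combination of blocks by 0 or 1, and vice versa; hence C(D̄) ⊆ C(D) ⊆ C(D̄) ∪ (1 ⊕ C(D̄)).
-- Only the self-duality of C(D) is used.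
module Submission where

open import Defs
open import Data.Nat using (ℕ; _%_)
open import Data.Bool using (Bool; true; false; _xor_)
open import Data.Bool.Properties using (xor-assoc; xor-comm; not-involutive)
open import Data.Vec using (Vec; []; _∷_)
open import Data.List using (List)
import Data.List as List
open import Data.List.Relation.Binary.Pointwise using (Pointwise; []; _∷_; symmetric)
open import Data.Fin.Subset using (Subset; ∁)
open import Data.Product using (_×_; _,_)
open import Data.Sum using (_⊎_; inj₁; inj₂; [_,_]; map)
open import Algebra.Definitions using (Associative; Commutative)
open import Algebra.Bundles using (CommutativeSemigroup)
import Algebra.Properties.CommutativeSemigroup as CommutativeSemigroupProperties
open import Relation.Binary.PropositionalEquality
  using (_≡_; refl; sym; trans; cong; cong₂; subst; module ≡-Reasoning)
open import Relation.Binary.PropositionalEquality.Algebra using (isMagma)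
open import Relation.Nullary using (¬_)
open import Function using (id)

private
  variable
    v : ℕ

⊕-assoc : Associative _≡_ (_⊕_ {v})
⊕-assoc []       []       []       = refl
⊕-assoc (x ∷ xs) (y ∷ ys) (z ∷ zs) = cong₂ _∷_ (xor-assoc x y z) (⊕-assoc xs ys zs)

⊕-comm : Commutative _≡_ (_⊕_ {v})
⊕-comm []       []       = refl
⊕-comm (x ∷ xs) (y ∷ ys) = cong₂ _∷_ (xor-comm x y) (⊕-comm xs ys)

⊕-identityˡ : (w : Word v) → zeroW ⊕ w ≡ w
⊕-identityˡ []       = refl
⊕-identityˡ (x ∷ xs) = cong (x ∷_) (⊕-identityˡ xs)

⊕-cancelˡ : (a w : Word v) → a ⊕ (a ⊕ w) ≡ w
⊕-cancelˡ []       []       = refl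
⊕-cancelˡ (a ∷ as) (x ∷ xs) = cong₂ _∷_ (xor-cancelˡ a x) (⊕-cancelˡ as xs)
  where
  xor-cancelˡ : ∀ a x → a xor (a xor x) ≡ x
  xor-cancelˡ true  x = not-involutive x
  xor-cancelˡ false x = refl

⊕-commutativeSemigroup : ℕ → CommutativeSemigroup _ _
⊕-commutativeSemigroup v = record
  { isCommutativeSemigroup = record
    { isSemigroup = record { isMagma = isMagma (_⊕_ {v}) ; assoc = ⊕-assoc }
    ; comm        = ⊕-comm
    }
  }

open module ⊕-Properties {v} = CommutativeSemigroupProperties (⊕-commutativeSemigroup v)
  using (x∙yz≈y∙xz)

⊕-cancel-shared : (g x y : Word v) → (g ⊕ x) ⊕ (g ⊕ y) ≡ x ⊕ y
⊕-cancel-shared g x y = begin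
  (g ⊕ x) ⊕ (g ⊕ y)  ≡⟨ ⊕-assoc g x (g ⊕ y) ⟩
  g ⊕ (x ⊕ (g ⊕ y))  ≡⟨ cong (g ⊕_) (x∙yz≈y∙xz x g y) ⟩
  g ⊕ (g ⊕ (x ⊕ y))  ≡⟨ ⊕-cancelˡ g (x ⊕ y) ⟩
  x ⊕ y              ∎
  where open ≡-Reasoning

∁-as-⊕ : (b : Subset v) → ∁ b ≡ allOne ⊕ b
∁-as-⊕ []      = refl
∁-as-⊕ (_ ∷ b) = cong (_ ∷_) (∁-as-⊕ b)

inner-allOne : (u : Word v) → inner u allOne ≡ inner u u
inner-allOne []          = refl
inner-allOne (true  ∷ u) = cong (true xor_) (inner-allOne u)
inner-allOne (false ∷ u) = inner-allOne u

selfDual⇒allOne : {K : Code v} → SelfDual K → K allOne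
selfDual⇒allOne (K⊆K⊥ , K⊥⊆K) = K⊥⊆K allOne λ u u∈K →
  trans (inner-allOne u) (K⊆K⊥ u u∈K u u∈K)

combo-⊕ : (gs : List (Word v)) (c d : Vec Bool (List.length gs)) →
          combo gs (c ⊕ d) ≡ combo gs c ⊕ combo gs d
combo-⊕ List.[]        []          []          = sym (⊕-identityˡ zeroW)
combo-⊕ (g List.∷ gs) (true  ∷ c) (true  ∷ d) =
  trans (combo-⊕ gs c d) (sym (⊕-cancel-shared g _ _))
combo-⊕ (g List.∷ gs) (true  ∷ c) (false ∷ d) =
  trans (cong (g ⊕_) (combo-⊕ gs c d)) (sym (⊕-assoc g _ _))
combo-⊕ (g List.∷ gs) (false ∷ c) (true  ∷ d) =
  trans (cong (g ⊕_) (combo-⊕ gs c d)) (x∙yz≈y∙xz g _ _)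
combo-⊕ (g List.∷ gs) (false ∷ c) (false ∷ d) = combo-⊕ gs c d

C-⊕-closed : (gs : List (Word v)) {x y : Word v} → C gs x → C gs y → C gs (x ⊕ y)
C-⊕-closed gs (c , refl) (d , refl) = c ⊕ d , combo-⊕ gs c d

C-∷⁺ : {g u : Word v} {gs : List (Word v)} → C gs u → C (g List.∷ gs) (g ⊕ u)
C-∷⁺ {g = g} (c , e) = true ∷ c , cong (g ⊕_) e

C-∷⁺-skip : {g u : Word v} {gs : List (Word v)} → C gs u → C (g List.∷ gs) u
C-∷⁺-skip (c , e) = false ∷ c , e

Shifted : Word v → Word v → Word v → Set
Shifted a h g = h ≡ a ⊕ g

Shifted-sym : {a h g : Word v} → Shifted a h g → Shifted a g h
Shifted-sym {a = a} {g = g} refl = sym (⊕-cancelˡ a g)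

C-shift : {a : Word v} {hs gs : List (Word v)} → Pointwise (Shifted a) hs gs →
          {w : Word v} → C hs w → C gs w ⊎ C gs (a ⊕ w)
C-shift []            ([] , refl)        = inj₁ ([] , refl)
C-shift (_ ∷ hs~gs)   (false ∷ c , refl) = map C-∷⁺-skip C-∷⁺-skip (C-shift hs~gs (c , refl))
C-shift {a = a} (_∷_ {y = g} refl hs~gs) (true ∷ c , refl) with C-shift hs~gs (c , refl)
... | inj₁ u∈  = inj₂ (subst (C _) (sym (trans (cong (a ⊕_) (⊕-assoc a g _)) (⊕-cancelˡ a _)))
                              (C-∷⁺ u∈))
... | inj₂ au∈ = inj₁ (subst (C _) (trans (x∙yz≈y∙xz g a _) (sym (⊕-assoc a g _))) (C-∷⁺ au∈))

C-shift-⊆ : {a : Word v} {hs gs : List (Word v)} →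
            C gs a → Pointwise (Shifted a) hs gs → C hs ⊆C C gs
C-shift-⊆ {a = a} {gs = gs} a∈ hs~gs w w∈ =
  [ id , (λ aw∈ → subst (C gs) (⊕-cancelˡ a w) (C-⊕-closed gs a∈ aw∈)) ]
  (C-shift hs~gs w∈)

complement-shifted : (B : List (Subset v)) → Pointwise (Shifted allOne) (complement B) B
complement-shifted List.[]       = []
complement-shifted (b List.∷ B) = ∁-as-⊕ b ∷ complement-shifted B

lemma2p2 : (t v k lam : ℕ) (B : List (Subset v)) →
    IsDesign t v k lam B → SelfOrthogonal k B → k % 2 ≡ 0 → SelfDual (C B) →
    (C (complement B) allOne → C B ≐ C (complement B)) ×
    (¬ C (complement B) allOne → Index2 (C B) (C (complement B)))
lemma2p2 t v k lam B _ _ _ selfDual = equal , index2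
  where
  allOne∈C : C B allOne
  allOne∈C = selfDual⇒allOne selfDual

  B̄~B : Pointwise (Shifted allOne) (complement B) B
  B̄~B = complement-shifted B

  B~B̄ : Pointwise (Shifted allOne) B (complement B)
  B~B̄ = symmetric Shifted-sym B̄~B

  C̄⊆C : C (complement B) ⊆C C B
  C̄⊆C = C-shift-⊆ allOne∈C B̄~B

  equal : C (complement B) allOne → C B ≐ C (complement B)
  equal allOne∈C̄ = C-shift-⊆ allOne∈C̄ B~B̄ , C̄⊆C

  index2 : ¬ C (complement B) allOne → Index2 (C B) (C (complement B))
  index2 allOne∉C̄ = C̄⊆C , allOne , allOne∈C , allOne∉C̄ , λ _ → C-shift B~B̄
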